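{- The number $a(n)$ of two-dimensional partitions $p$ with $p\vdash (n,|p|-1)$ and $(0,1)\notin p$ (equivalently, the number of distinct terms in the formula $\frac{d^ny}{dx^n}=\sum_{p\vdash (n,|p|-1),\,(0,1)\notin p}(-1)^{|p|}\alpha_p F_{x,y,p}/F_y^{|p|}$) is given by \[ a(n)=\text{Coefficient of } t^nu^{n-1} \text{ in } \prod_{(i,j)\in E}\frac{1}{1-t^iu^{i+j-1}}, \] where $E=\mathbb N\times\mathbb N\setminus\{(0,0),(0,1)\}$ and $\mathbb N$ includes $0$.
   Context: A two-dimensional partition $p\vdash(m,n)$ of a pair of non-negative integers (not both zero) is a lexicographically ordered sequence $(p_1,q_1)\geq\dots\geq(p_r,q_r)>0$ of pairs of non-negative integers (each pair not both zero) with $\sum_i p_i=m$ and $\sum_i q_i=n$; $|p|=r$ denotes the number of parts. In the displayed formula, $F(x,y)=0$ defines $y$ implicitly as a function of $x$, $\alpha_p=\frac{n!\,m!}{\prod_i p_{i1}!p_{i2}!\prod_{k,l}e_{p,k,l}!}$ with $e_{p,k,l}$ the multiplicity of part $(k,l)$ in $p$, and $F_{x,y,p}=\prod_i\partial^{p_{i1}+p_{i2}}F/\partial x^{p_{i1}}\partial y^{p_{i2}}$. -}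

module Defs where

open import Data.Nat using (ℕ; zero; suc; _+_; _*_; _∸_; _≤_; _<_; _≡ᵇ_)
open import Data.Bool using (Bool; true; false; if_then_else_; _∧_; _∨_; not)
open import Data.Product using (_×_; _,_; proj₁; proj₂; Σ; ∃)
open import Data.Sum using (_⊎_)
open import Data.Nat.ListAction using (sum)
open import Data.List using (List; []; _∷_; map; length; upTo; filterᵇ; cartesianProduct; foldr)
open import Data.List.Relation.Unary.All using (All)
open import Data.List.Relation.Unary.Linked using (Linked)
open import Data.List.Membership.Propositional using (_∈_)
open import Relation.Binary.PropositionalEquality using (_≡_)
open import Relation.Nullary using (¬_)

Pair : Set
Pair = ℕ × ℕ

NonZeroPair : Pair → Set
NonZeroPair (a , b) = ¬ ((a ≡ 0) × (b ≡ 0))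

_≥ₗ_ : Pair → Pair → Set
(a , b) ≥ₗ (c , d) = (c < a) ⊎ ((a ≡ c) × (d ≤ b))

-- p ⊢ (m , n): lexicographically non-increasing list of nonzero pairs
-- whose first coordinates sum to m and second coordinates sum to n.
-- (The condition that (m , n) is not both zero is a separate hypothesis.)
record TwoDimPartition (m n : ℕ) (p : List Pair) : Set where
  field
    sorted   : Linked _≥ₗ_ p
    nonzero  : All NonZeroPair p
    sumFst   : sum (map proj₁ p) ≡ m
    sumSnd   : sum (map proj₂ p) ≡ n

Counted : ℕ → List Pair → Set
Counted n p = TwoDimPartition n (length p ∸ 1) p × ¬ ((0 , 1) ∈ p)

-- Formal power series in t, u with ℕ coefficients:  f a b = coeff of t^a u^b

Series : Set
Series = ℕ → ℕ → ℕ

oneS : Series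
oneS zero zero = 1
oneS _    _    = 0

_⊛_ : Series → Series → Series
(f ⊛ g) a b = sum (map (λ i → sum (map (λ k → f i k * g (a ∸ i) (b ∸ k)) (upTo (suc b)))) (upTo (suc a)))

-- 1 / (1 - t^i u^k) = Σ_{m ≥ 0} t^(m i) u^(m k);
-- coefficient of t^a u^b is the number of m ≥ 0 with m i = a and m k = b
-- (for (i , k) ≠ (0 , 0) any such m satisfies m ≤ a + b).
geomS : ℕ → ℕ → Series
geomS i k a b = sum (map (λ m → if (m * i ≡ᵇ a) ∧ (m * k ≡ᵇ b) then 1 else 0) (upTo (suc (a + b))))

inEᵇ : Pair → Bool
inEᵇ (i , j) = not ((i ≡ᵇ 0) ∧ ((j ≡ᵇ 0) ∨ (j ≡ᵇ 1)))

E≤ : ℕ → List Pair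
E≤ N = filterᵇ inEᵇ (cartesianProduct (upTo (suc N)) (upTo (suc N)))

factor : Pair → Series
factor (i , j) = geomS i (i + j ∸ 1)

partialProduct : ℕ → Series
partialProduct N = foldr _⊛_ oneS (map factor (E≤ N))

-- The coefficient of t^a u^b in the infinite product ∏_{(i,j)∈E} equals c:
-- the partial products' coefficient stabilises at c (convergence in the
-- (t,u)-adic topology of formal power series).
InfProdCoeff : ℕ → ℕ → ℕ → Set
InfProdCoeff a b c = Σ ℕ λ N₀ → (N : ℕ) → N₀ ≤ N → partialProduct N a b ≡ c

module Submission where

-- The coefficient of t^a u^b in a finite product  ∏_{e ∈ es} 1/(1 - t^i u^k),  where a
-- letter e = (i , j) has bidegree (i , k) with k = i + j - 1, counts the lexicographically
-- non-increasing lists of letters of es of total bidegree (a , b).  We make this literal: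
-- for an alphabet es listed in strictly increasing order, enum es a b lists exactly these
-- sorted lists, and it is built by the same nested sums as the Cauchy product _⊛_ and the
-- geometric series geomS, so its length IS the coefficient of the product (length-enum).
--
-- For a partition p ⊢ (n , |p| - 1) with (0 , 1) ∉ p, the identity
-- Σ (i + j - 1) + |p| = Σ i + Σ j  turns the condition on Σ j into "u-degree n - 1", and all
-- parts lie in the truncation E≤ N of E once N ≥ n.  So for every N ≥ n the members of
-- enum (E≤ N) n (n - 1) are exactly the counted partitions; two repetition-free lists with
-- the same members have the same length, hence the coefficient of t^n u^(n-1) of the
-- partial product is the same for all N ≥ n and equals the number a(n) of such partitions.

open import Defs
open import Data.Bool using (Bool; true; false; if_then_else_; _∧_; T)
open import Data.Bool.Properties using (T-∧)
open import Data.Empty using (⊥-elim)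
open import Data.List using (List; []; _∷_; _++_; map; length; upTo; replicate; filter; concatMap; cartesianProduct; foldr)
open import Data.List.Properties using (length-++; length-map; length-replicate; map-cong; map-++; ++-cancelʳ; filter-++; filter-all; filter-none)
open import Data.List.Membership.Propositional using (_∈_; find; lose)
open import Data.List.Membership.Propositional.Properties using (∈-map⁺; ∈-map⁻; ∈-concatMap⁺; ∈-concatMap⁻; ∈-upTo⁺; ∈-upTo⁻; ∈-filter⁺; ∈-filter⁻; ∈-cartesianProduct⁺; ∈-cartesianProduct⁻)
open import Data.List.Membership.Propositional.Properties.WithK using (unique∧set⇒bag)
open import Data.List.Relation.Binary.BagAndSetEquality using (∼bag⇒↭)
open import Data.List.Relation.Binary.Permutation.Propositional.Properties using (↭-length)
open import Data.List.Relation.Unary.All as All using (All; []; _∷_; lookup)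
import Data.List.Relation.Unary.All.Properties as AllP
open import Data.List.Relation.Unary.AllPairs using (AllPairs; []; _∷_)
import Data.List.Relation.Unary.AllPairs as AllPairs
import Data.List.Relation.Unary.AllPairs.Properties as AllPairsP
open import Data.List.Relation.Unary.Any using (here; there)
open import Data.List.Relation.Unary.Linked using (Linked; []; [-]; _∷_)
import Data.List.Relation.Unary.Linked as Linked
open import Data.List.Relation.Unary.Unique.Propositional using (Unique)
import Data.List.Relation.Unary.Unique.Propositional.Properties as UniqueP
open import Data.Nat using (ℕ; zero; suc; _+_; _*_; _∸_; _≤_; _<_; _≡ᵇ_; _≟_; z≤n; s≤s)
open import Data.Nat.Properties
open import Algebra.Properties.CommutativeSemigroup +-commutativeSemigroup using (interchange)
open import Data.Nat.ListAction using (sum)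
open import Data.Nat.ListAction.Properties using (sum-++)
open import Data.Product using (Σ; ∃; ∃₂; _×_; _,_; proj₁; proj₂)
open import Data.Product.Properties using (≡-dec)
open import Data.Sum using (_⊎_; inj₁; inj₂)
open import Data.Unit using (tt)
open import Function using (_∘_; id)
open import Function.Bundles using (_⇔_; mk⇔; Equivalence)
open import Function.Construct.Composition using (_⇔-∘_)
open import Function.Construct.Symmetry using (⇔-sym)
open import Relation.Binary.PropositionalEquality
open import Relation.Nullary using (¬_; Dec)
open import Relation.Nullary.Decidable using (T?)

length-concatMap : ∀ {A B : Set} (f : A → List B) (xs : List A) →
                   length (concatMap f xs) ≡ sum (map (length ∘ f) xs)
length-concatMap f []       = refl
length-concatMap f (x ∷ xs) =
  trans (length-++ (f x)) (cong (length (f x) +_) (length-concatMap f xs))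

sum-cong : ∀ {A : Set} {f g : A → ℕ} → (∀ x → f x ≡ g x) → ∀ xs →
           sum (map f xs) ≡ sum (map g xs)
sum-cong f≗g xs = cong sum (map-cong f≗g xs)

sum-*ʳ : ∀ {A : Set} (f : A → ℕ) c xs → sum (map (λ x → f x * c) xs) ≡ sum (map f xs) * c
sum-*ʳ f c []       = refl
sum-*ʳ f c (x ∷ xs) =
  trans (cong (f x * c +_) (sum-*ʳ f c xs)) (sym (*-distribʳ-+ c (f x) (sum (map f xs))))

∈⇒≤sum : ∀ {A : Set} (f : A → ℕ) {x xs} → x ∈ xs → f x ≤ sum (map f xs)
∈⇒≤sum f {xs = y ∷ xs} (here refl) = m≤m+n (f y) _
∈⇒≤sum f {xs = y ∷ xs} (there x∈) = ≤-trans (∈⇒≤sum f x∈) (m≤n+m _ (f y))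

∈-concatMap-index : ∀ {A B : Set} (f : A → List B) xs {y} → y ∈ concatMap f xs →
                    ∃ λ x → x ∈ xs × y ∈ f x
∈-concatMap-index f xs y∈ = find (∈-concatMap⁻ f y∈)

∈-concatMap-at : ∀ {A B : Set} (f : A → List B) {xs x y} → x ∈ xs → y ∈ f x →
                 y ∈ concatMap f xs
∈-concatMap-at f x∈ y∈ = ∈-concatMap⁺ f (lose x∈ y∈)

upTo-bound : ∀ {n i} → i ∈ upTo (suc n) → i ≤ n
upTo-bound = ≤-pred ∘ ∈-upTo⁻

concatMap-unique : ∀ {A B : Set} (g : B → A) (f : A → List B) {xs} → Unique xs →
                   (∀ x → Unique (f x)) → (∀ {x y} → y ∈ f x → g y ≡ x) →
                   Unique (concatMap f xs)
concatMap-unique g f {[]}     []            _        _     = []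
concatMap-unique g f {x ∷ xs} (x∉xs ∷ uniq) unique-f index =
  UniqueP.++⁺ (unique-f x) (concatMap-unique g f uniq unique-f index) disjoint
  where
    disjoint : ∀ {y} → ¬ (y ∈ f x × y ∈ concatMap f xs)
    disjoint (y∈fx , y∈rest) with x′ , x′∈xs , y∈fx′ ← ∈-concatMap-index f xs y∈rest =
      lookup x∉xs x′∈xs (trans (sym (index y∈fx)) (index y∈fx′))

sameMembers⇒sameLength : ∀ {A : Set} {xs ys : List A} → Unique xs → Unique ys →
                         (∀ {x} → x ∈ xs ⇔ x ∈ ys) → length xs ≡ length ys
sameMembers⇒sameLength uxs uys same = ↭-length (∼bag⇒↭ (unique∧set⇒bag uxs uys same))

uDeg : Pair → ℕ
uDeg (i , j) = i + j ∸ 1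

tDegree : List Pair → ℕ
tDegree p = sum (map proj₁ p)

uDegree : List Pair → ℕ
uDegree p = sum (map uDeg p)

degree-extend : ∀ (f : Pair → ℕ) q m e →
                sum (map f (q ++ replicate m e)) ≡ sum (map f q) + m * f e
degree-extend f q m e = begin
  sum (map f (q ++ replicate m e))            ≡⟨ cong sum (map-++ f q (replicate m e)) ⟩
  sum (map f q ++ map f (replicate m e))      ≡⟨ sum-++ (map f q) _ ⟩
  sum (map f q) + sum (map f (replicate m e)) ≡⟨ cong (sum (map f q) +_) (copies m) ⟩
  sum (map f q) + m * f e                     ∎
  where
    open ≡-Reasoning
    copies : ∀ m → sum (map f (replicate m e)) ≡ m * f e
    copies zero    = refl
    copies (suc m) = cong (f e +_) (copies m)

_<ₗ_ : Pair → Pair → Set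
(a , b) <ₗ (c , d) = (a < c) ⊎ ((a ≡ c) × (b < d))

<ₗ⇒≥ₗ : ∀ {x y} → x <ₗ y → y ≥ₗ x
<ₗ⇒≥ₗ {a , b} {c , d} (inj₁ a<c)          = inj₁ a<c
<ₗ⇒≥ₗ {a , b} {c , d} (inj₂ (refl , b<d)) = inj₂ (refl , <⇒≤ b<d)

≥ₗ-refl : ∀ x → x ≥ₗ x
≥ₗ-refl (a , b) = inj₂ (refl , ≤-refl)

≥ₗ⇒≮ₗ : ∀ {x y} → x ≥ₗ y → ¬ (x <ₗ y)
≥ₗ⇒≮ₗ {a , b} {c , d} (inj₁ c<a)          (inj₁ a<c)        = <-asym c<a a<c
≥ₗ⇒≮ₗ {a , b} {c , d} (inj₁ c<a)          (inj₂ (refl , _)) = <-irrefl refl c<a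
≥ₗ⇒≮ₗ {a , b} {c , d} (inj₂ (refl , _))   (inj₁ a<c)        = <-irrefl refl a<c
≥ₗ⇒≮ₗ {a , b} {c , d} (inj₂ (refl , d≤b)) (inj₂ (_ , b<d))  = <-irrefl refl (<-≤-trans b<d d≤b)

<ₗ-irrefl : ∀ {x} → ¬ (x <ₗ x)
<ₗ-irrefl {x} = ≥ₗ⇒≮ₗ (≥ₗ-refl x)

record SortedOver (es : List Pair) (a b : ℕ) (p : List Pair) : Set where
  field
    sorted    : Linked _≥ₗ_ p
    letters   : All (_∈ es) p
    tDegree≡  : tDegree p ≡ a
    uDegree≡  : uDegree p ≡ b
open SortedOver

replicate-sorted : ∀ m e → Linked _≥ₗ_ (replicate m e)
replicate-sorted zero          e = []
replicate-sorted (suc zero)    e = [-]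
replicate-sorted (suc (suc m)) e = ≥ₗ-refl e ∷ replicate-sorted (suc m) e

extend-sorted : ∀ {e q} m → Linked _≥ₗ_ q → All (_≥ₗ e) q → Linked _≥ₗ_ (q ++ replicate m e)
extend-sorted m       []         _          = replicate-sorted m _
extend-sorted zero    [-]        _          = [-]
extend-sorted (suc m) [-]        (x≥e ∷ []) = x≥e ∷ replicate-sorted (suc m) _
extend-sorted m       (x≥y ∷ lq) (_ ∷ q≥e)  = x≥y ∷ extend-sorted m lq q≥e

split-sorted : ∀ {e es} → All (e <ₗ_) es → ∀ p → Linked _≥ₗ_ p → All (_∈ e ∷ es) p →
               ∃₂ λ q m → p ≡ q ++ replicate m e × Linked _≥ₗ_ q × All (_∈ es) q
split-sorted e<es []      _  _           = [] , 0 , refl , [] , []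
split-sorted e<es (x ∷ p) lp (x∈ ∷ p∈) with split-sorted e<es p (Linked.tail lp) p∈
split-sorted e<es (x ∷ _) lp (here refl ∷ _) | [] , m , refl , _ , _ =
  [] , suc m , refl , [] , []
split-sorted e<es (x ∷ _) (e≥y ∷ _) (here refl ∷ _) | y ∷ _ , _ , refl , _ , y∈es ∷ _ =
  ⊥-elim (≥ₗ⇒≮ₗ e≥y (lookup e<es y∈es))
split-sorted e<es (x ∷ _) lp (there x∈es ∷ _) | [] , m , refl , _ , _ =
  x ∷ [] , m , refl , [-] , x∈es ∷ []
split-sorted e<es (x ∷ _) (x≥y ∷ _) (there x∈es ∷ _) | y ∷ q , m , refl , lq , q∈ =
  x ∷ y ∷ q , m , refl , x≥y ∷ lq , x∈es ∷ q∈

extend-degree : ∀ (f : Pair → ℕ) q m e {d} → m * f e ≤ d → sum (map f q) ≡ d ∸ m * f e →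
                sum (map f (q ++ replicate m e)) ≡ d
extend-degree f q m e {d} c≤d q≡ = begin
  sum (map f (q ++ replicate m e)) ≡⟨ degree-extend f q m e ⟩
  sum (map f q) + m * f e          ≡⟨ cong (_+ m * f e) q≡ ⟩
  d ∸ m * f e + m * f e            ≡⟨ m∸n+n≡m c≤d ⟩
  d                                ∎
  where open ≡-Reasoning

split-degree : ∀ (f : Pair → ℕ) q m e {d} → sum (map f (q ++ replicate m e)) ≡ d →
               m * f e ≤ d × sum (map f q) ≡ d ∸ m * f e
split-degree f q m e refl rewrite degree-extend f q m e =
  m≤n+m (m * f e) (sum (map f q)) , sym (m+n∸n≡m (sum (map f q)) (m * f e))

_≟ₚ_ : (x y : Pair) → Dec (x ≡ y)
_≟ₚ_ = ≡-dec _≟_ _≟_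

multiplicity : Pair → List Pair → ℕ
multiplicity e p = length (filter (_≟ₚ e) p)

multiplicity-extend : ∀ e q m → All (_≢ e) q → multiplicity e (q ++ replicate m e) ≡ m
multiplicity-extend e q m q≢e = begin
  length (filter (_≟ₚ e) (q ++ replicate m e))
    ≡⟨ cong length (filter-++ (_≟ₚ e) q (replicate m e)) ⟩
  length (filter (_≟ₚ e) q ++ filter (_≟ₚ e) (replicate m e))
    ≡⟨ cong₂ (λ xs ys → length (xs ++ ys)) (filter-none (_≟ₚ e) q≢e)
                                            (filter-all (_≟ₚ e) (AllP.replicate⁺ m refl)) ⟩
  length (replicate m e)
    ≡⟨ length-replicate m ⟩
  m ∎
  where open ≡-Reasoning

-- A letter of positive total degree occurs at most a + b times in bidegree (a , b).
Positive : Pair → Set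
Positive e = 1 ≤ proj₁ e + uDeg e

copies-bound : ∀ e m → Positive e → m ≤ m * proj₁ e + m * uDeg e
copies-bound e m pos = begin
  m                           ≡⟨ sym (*-identityʳ m) ⟩
  m * 1                       ≤⟨ *-monoʳ-≤ m pos ⟩
  m * (proj₁ e + uDeg e)      ≡⟨ *-distribˡ-+ m (proj₁ e) (uDeg e) ⟩
  m * proj₁ e + m * uDeg e    ∎
  where open ≤-Reasoning

isPowerᵇ : Pair → ℕ → ℕ → ℕ → Bool
isPowerᵇ e a b m = (m * proj₁ e ≡ᵇ a) ∧ (m * uDeg e ≡ᵇ b)

isPower-sound : ∀ e a b m → T (isPowerᵇ e a b m) → m * proj₁ e ≡ a × m * uDeg e ≡ b
isPower-sound e a b m power with tEq , uEq ← Equivalence.to T-∧ power =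
  ≡ᵇ⇒≡ _ _ tEq , ≡ᵇ⇒≡ _ _ uEq

isPower-complete : ∀ e m → T (isPowerᵇ e (m * proj₁ e) (m * uDeg e) m)
isPower-complete e m =
  Equivalence.from T-∧ (≡⇒≡ᵇ (m * proj₁ e) _ refl , ≡⇒≡ᵇ (m * uDeg e) _ refl)

indicator : Bool → ℕ
indicator c = if c then 1 else 0

Enumeration : Set
Enumeration = ℕ → ℕ → List (List Pair)

extensions : Pair → Enumeration → (a b a′ b′ m : ℕ) → List (List Pair)
extensions e rest a b a′ b′ m =
  if isPowerᵇ e a′ b′ m then map (_++ replicate m e) (rest (a ∸ a′) (b ∸ b′)) else []

extensionsAt : Pair → Enumeration → (a b a′ b′ : ℕ) → List (List Pair)
extensionsAt e rest a b a′ b′ = concatMap (extensions e rest a b a′ b′) (upTo (suc (a′ + b′)))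

extensionsAtT : Pair → Enumeration → (a b a′ : ℕ) → List (List Pair)
extensionsAtT e rest a b a′ = concatMap (extensionsAt e rest a b a′) (upTo (suc b))

-- The sorted lists over es of bidegree (a , b), following the nested sums of
-- foldr _⊛_ oneS (map factor es).
enum : List Pair → Enumeration
enum []       a b = if (a ≡ᵇ 0) ∧ (b ≡ᵇ 0) then [] ∷ [] else []
enum (e ∷ es) a b = concatMap (extensionsAtT e (enum es) a b) (upTo (suc a))

length-extensions : ∀ e rest a b a′ b′ m →
  length (extensions e rest a b a′ b′ m) ≡ indicator (isPowerᵇ e a′ b′ m) * length (rest (a ∸ a′) (b ∸ b′))
length-extensions e rest a b a′ b′ m with isPowerᵇ e a′ b′ m
... | true  = trans (length-map (_++ replicate m e) (rest (a ∸ a′) (b ∸ b′))) (sym (+-identityʳ _))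
... | false = refl

length-extensionsAt : ∀ e rest a b a′ b′ →
  length (extensionsAt e rest a b a′ b′) ≡ factor e a′ b′ * length (rest (a ∸ a′) (b ∸ b′))
length-extensionsAt e rest a b a′ b′ = begin
  length (extensionsAt e rest a b a′ b′)
    ≡⟨ length-concatMap (extensions e rest a b a′ b′) ms ⟩
  sum (map (length ∘ extensions e rest a b a′ b′) ms)
    ≡⟨ sum-cong (length-extensions e rest a b a′ b′) ms ⟩
  sum (map (λ m → indicator (isPowerᵇ e a′ b′ m) * completions) ms)
    ≡⟨ sum-*ʳ (indicator ∘ isPowerᵇ e a′ b′) completions ms ⟩
  factor e a′ b′ * completions ∎
  where
    open ≡-Reasoning
    ms = upTo (suc (a′ + b′))
    completions = length (rest (a ∸ a′) (b ∸ b′))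

-- The length of the enumeration is the coefficient of the finite product: the two outer
-- concatMaps are the two sums of _⊛_, the innermost one the sum of geomS.
length-enum : ∀ es a b → length (enum es a b) ≡ foldr _⊛_ oneS (map factor es) a b
length-enum []       zero    zero    = refl
length-enum []       zero    (suc b) = refl
length-enum []       (suc a) b       = refl
length-enum (e ∷ es) a b =
  trans (length-concatMap (extensionsAtT e (enum es) a b) (upTo (suc a))) (sum-cong (λ a′ →
  trans (length-concatMap (extensionsAt e (enum es) a b a′) (upTo (suc b))) (sum-cong (λ b′ →
  trans (length-extensionsAt e (enum es) a b a′ b′)
        (cong (factor e a′ b′ *_) (length-enum es (a ∸ a′) (b ∸ b′))))
    (upTo (suc b)))) (upTo (suc a)))

∈-extensions⁻ : ∀ e rest a b a′ b′ m {p} → p ∈ extensions e rest a b a′ b′ m →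
  T (isPowerᵇ e a′ b′ m) × ∃ λ q → q ∈ rest (a ∸ a′) (b ∸ b′) × p ≡ q ++ replicate m e
∈-extensions⁻ e rest a b a′ b′ m p∈ with isPowerᵇ e a′ b′ m
... | true = tt , ∈-map⁻ (_++ replicate m e) p∈

∈-extensions⁺ : ∀ e rest a b a′ b′ m {q} → T (isPowerᵇ e a′ b′ m) →
  q ∈ rest (a ∸ a′) (b ∸ b′) → q ++ replicate m e ∈ extensions e rest a b a′ b′ m
∈-extensions⁺ e rest a b a′ b′ m power q∈ with isPowerᵇ e a′ b′ m
... | true = ∈-map⁺ (_++ replicate m e) q∈

record Extension (e : Pair) (es : List Pair) (a b : ℕ) (p : List Pair) : Set where
  constructor extension
  field
    count : ℕ
    rest  : List Pair
    tFits : count * proj₁ e ≤ a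
    uFits : count * uDeg e ≤ b
    rest∈ : rest ∈ enum es (a ∸ count * proj₁ e) (b ∸ count * uDeg e)
    shape : p ≡ rest ++ replicate count e

-- The members of enum (e ∷ es) a b are exactly its extensions (the converse direction
-- needs e of positive degree, to bound the number of copies).
∈-enum-∷⁻ : ∀ e es a b {p} → p ∈ enum (e ∷ es) a b → Extension e es a b p
∈-enum-∷⁻ e es a b p∈
  with a′ , a′∈ , p∈₁ ← ∈-concatMap-index _ (upTo (suc a)) p∈
  with b′ , b′∈ , p∈₂ ← ∈-concatMap-index _ (upTo (suc b)) p∈₁
  with m , _ , p∈₃ ← ∈-concatMap-index _ (upTo (suc (a′ + b′))) p∈₂
  with power , q , q∈ , refl ← ∈-extensions⁻ e (enum es) a b a′ b′ m p∈₃
  with refl , refl ← isPower-sound e a′ b′ m power =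
  extension m q (upTo-bound a′∈) (upTo-bound b′∈) q∈ refl

∈-enum-∷⁺ : ∀ e es a b {p} → Positive e → Extension e es a b p → p ∈ enum (e ∷ es) a b
∈-enum-∷⁺ e es a b pos (extension m q ta≤ ub≤ q∈ refl) =
  ∈-concatMap-at (extensionsAtT e rest a b) (∈-upTo⁺ (s≤s ta≤))
    (∈-concatMap-at (extensionsAt e rest a b a′) (∈-upTo⁺ (s≤s ub≤))
      (∈-concatMap-at (extensions e rest a b a′ b′) (∈-upTo⁺ (s≤s (copies-bound e m pos)))
        (∈-extensions⁺ e rest a b a′ b′ m (isPower-complete e m) q∈)))
  where
    rest = enum es
    a′ = m * proj₁ e
    b′ = m * uDeg e

extend-sortedOver : ∀ {e es a b} m {q} → All (e <ₗ_) es → m * proj₁ e ≤ a → m * uDeg e ≤ b →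
  SortedOver es (a ∸ m * proj₁ e) (b ∸ m * uDeg e) q →
  SortedOver (e ∷ es) a b (q ++ replicate m e)
extend-sortedOver {e} m {q} e<es ta≤ ub≤ q-over = record
  { sorted   = extend-sorted m (sorted q-over) (All.map (λ x∈ → <ₗ⇒≥ₗ (lookup e<es x∈)) (letters q-over))
  ; letters  = AllP.++⁺ (All.map there (letters q-over)) (AllP.replicate⁺ m (here refl))
  ; tDegree≡ = extend-degree proj₁ q m e ta≤ (tDegree≡ q-over)
  ; uDegree≡ = extend-degree uDeg q m e ub≤ (uDegree≡ q-over)
  }

enum-sound : ∀ es → AllPairs _<ₗ_ es → ∀ a b {p} → p ∈ enum es a b → SortedOver es a b p
enum-sound []       _                   zero zero (here refl) =
  record { sorted = [] ; letters = [] ; tDegree≡ = refl ; uDegree≡ = refl }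
enum-sound (e ∷ es) (e<es ∷ es-sorted) a b {p} p∈ = sound (∈-enum-∷⁻ e es a b p∈)
  where
    sound : Extension e es a b p → SortedOver (e ∷ es) a b p
    sound (extension m q ta≤ ub≤ q∈ refl) =
      extend-sortedOver m e<es ta≤ ub≤ (enum-sound es es-sorted _ _ q∈)

enum-complete : ∀ es → AllPairs _<ₗ_ es → All Positive es → ∀ a b {p} →
                SortedOver es a b p → p ∈ enum es a b
enum-complete [] _ _ a b {[]} record { tDegree≡ = refl ; uDegree≡ = refl } = here refl
enum-complete [] _ _ a b {x ∷ p} record { letters = () ∷ _ }
enum-complete (e ∷ es) (e<es ∷ es-sorted) (pos ∷ es-pos) a b {p} p-over =
  ∈-enum-∷⁺ e es a b pos (complete (split-sorted e<es p (sorted p-over) (letters p-over)))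
  where
    complete : (∃₂ λ q m → p ≡ q ++ replicate m e × Linked _≥ₗ_ q × All (_∈ es) q) →
               Extension e es a b p
    complete (q , m , refl , q-sorted , q-letters)
      with ta≤ , q-tDegree ← split-degree proj₁ q m e (tDegree≡ p-over)
      with ub≤ , q-uDegree ← split-degree uDeg q m e (uDegree≡ p-over) =
      extension m q ta≤ ub≤ (enum-complete es es-sorted es-pos _ _ record
        { sorted = q-sorted ; letters = q-letters ; tDegree≡ = q-tDegree ; uDegree≡ = q-uDegree }) refl

extensions-unique : ∀ e rest a b a′ b′ m → Unique (rest (a ∸ a′) (b ∸ b′)) →
                    Unique (extensions e rest a b a′ b′ m)
extensions-unique e rest a b a′ b′ m uniq with isPowerᵇ e a′ b′ m
... | true  = UniqueP.map⁺ (λ {x} {y} → ++-cancelʳ (replicate m e) x y) uniq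
... | false = []

-- The enumeration has no repetitions: the number of letters e of a member determines the
-- indices a′ , b′ , m of the piece it comes from.
enum-unique : ∀ es → AllPairs _<ₗ_ es → ∀ a b → Unique (enum es a b)
enum-unique []       _                   zero    zero    = [] ∷ []
enum-unique []       _                   zero    (suc b) = []
enum-unique []       _                   (suc a) b       = []
enum-unique (e ∷ es) (e<es ∷ es-sorted) a b =
  concatMap-unique (λ p → multiplicity e p * proj₁ e) (extensionsAtT e rest a b) (UniqueP.upTo⁺ (suc a)) (λ a′ →
  concatMap-unique (λ p → multiplicity e p * uDeg e) (extensionsAt e rest a b a′) (UniqueP.upTo⁺ (suc b)) (λ b′ →
  concatMap-unique (multiplicity e) (extensions e rest a b a′ b′) (UniqueP.upTo⁺ (suc (a′ + b′))) (λ m →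
  extensions-unique e rest a b a′ b′ m (enum-unique es es-sorted _ _))
    (λ {m} → proj₁ ∘ copies a′ b′ m))
    (uIndex a′))
    tIndex
  where
    rest = enum es

    copies : ∀ a′ b′ m {p} → p ∈ extensions e rest a b a′ b′ m →
             multiplicity e p ≡ m × m * proj₁ e ≡ a′ × m * uDeg e ≡ b′
    copies a′ b′ m p∈ with power , q , q∈ , refl ← ∈-extensions⁻ e rest a b a′ b′ m p∈ =
      multiplicity-extend e q m (All.map avoids-e (letters (enum-sound es es-sorted _ _ q∈))) ,
      isPower-sound e a′ b′ m power
      where
        avoids-e : ∀ {x} → x ∈ es → x ≢ e
        avoids-e x∈ refl = <ₗ-irrefl (lookup e<es x∈)

    uIndex : ∀ a′ {b′ p} → p ∈ extensionsAt e rest a b a′ b′ → multiplicity e p * uDeg e ≡ b′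
    uIndex a′ {b′} p∈ with m , _ , p∈′ ← ∈-concatMap-index _ (upTo (suc (a′ + b′))) p∈
      with mult , _ , uEq ← copies a′ b′ m p∈′ = trans (cong (_* uDeg e) mult) uEq

    tIndex : ∀ {a′ p} → p ∈ extensionsAtT e rest a b a′ → multiplicity e p * proj₁ e ≡ a′
    tIndex {a′} p∈ with b′ , _ , p∈₁ ← ∈-concatMap-index _ (upTo (suc b)) p∈
      with m , _ , p∈₂ ← ∈-concatMap-index _ (upTo (suc (a′ + b′))) p∈₁
      with mult , tEq , _ ← copies a′ b′ m p∈₂ = trans (cong (_* proj₁ e) mult) tEq

inE⇒nonZero : ∀ i j → T (inEᵇ (i , j)) → NonZeroPair (i , j)
inE⇒nonZero (suc i) j             _ (() , _)
inE⇒nonZero zero    (suc (suc j)) _ (_ , ())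

nonZero⇒inE : ∀ i j → NonZeroPair (i , j) → (i , j) ≢ (0 , 1) → T (inEᵇ (i , j))
nonZero⇒inE (suc i) j             _  _  = tt
nonZero⇒inE zero    zero          nz _  = nz (refl , refl)
nonZero⇒inE zero    (suc zero)    _  ≢01 = ≢01 refl
nonZero⇒inE zero    (suc (suc j)) _  _  = tt

inE⇒positive : ∀ i j → T (inEᵇ (i , j)) → Positive (i , j)
inE⇒positive (suc i) j             _ = s≤s z≤n
inE⇒positive zero    (suc (suc j)) _ = s≤s z≤n

cartesianProduct-sorted : ∀ xs ys → AllPairs _<_ xs → AllPairs _<_ ys →
                          AllPairs _<ₗ_ (cartesianProduct xs ys)
cartesianProduct-sorted []       ys _              _     = []
cartesianProduct-sorted (x ∷ xs) ys (x<xs ∷ xs<) ys< =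
  AllPairsP.++⁺ (AllPairsP.map⁺ (AllPairs.map (λ y<y′ → inj₂ (refl , y<y′)) ys<))
                (cartesianProduct-sorted xs ys xs< ys<)
                (All.tabulate λ z∈ → All.tabulate λ w∈ → row<rest z∈ w∈)
  where
    row<rest : ∀ {z w} → z ∈ map (x ,_) ys → w ∈ cartesianProduct xs ys → z <ₗ w
    row<rest {w = w₁ , w₂} z∈ w∈ with _ , _ , refl ← ∈-map⁻ (x ,_) z∈ =
      inj₁ (lookup x<xs (proj₁ (∈-cartesianProduct⁻ xs ys w∈)))

upTo-sorted : ∀ n → AllPairs _<_ (upTo n)
upTo-sorted n = AllPairsP.applyUpTo⁺₁ id n (λ i<j _ → i<j)

E≤-sorted : ∀ N → AllPairs _<ₗ_ (E≤ N)
E≤-sorted N = AllPairsP.filter⁺ (T? ∘ inEᵇ)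
  (cartesianProduct-sorted (upTo (suc N)) (upTo (suc N)) (upTo-sorted _) (upTo-sorted _))

∈-E≤⁻ : ∀ N {x} → x ∈ E≤ N → T (inEᵇ x)
∈-E≤⁻ N x∈ = proj₂ (∈-filter⁻ (T? ∘ inEᵇ) {xs = cartesianProduct (upTo (suc N)) (upTo (suc N))} x∈)

∈-E≤⁺ : ∀ N i j → T (inEᵇ (i , j)) → i ≤ N → j ≤ N → (i , j) ∈ E≤ N
∈-E≤⁺ N i j inE i≤N j≤N =
  ∈-filter⁺ (T? ∘ inEᵇ) (∈-cartesianProduct⁺ (∈-upTo⁺ (s≤s i≤N)) (∈-upTo⁺ (s≤s j≤N))) inE

E≤-positive : ∀ N → All Positive (E≤ N)
E≤-positive N = All.tabulate λ { {i , j} x∈ → inE⇒positive i j (∈-E≤⁻ N x∈) }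

suc-uDeg : ∀ x → NonZeroPair x → suc (uDeg x) ≡ proj₁ x + proj₂ x
suc-uDeg (i , j) nz = trans (+-comm 1 (i + j ∸ 1)) (m∸n+n≡m (positive-sum i j nz))
  where
    positive-sum : ∀ i j → NonZeroPair (i , j) → 1 ≤ i + j
    positive-sum (suc i) j       _  = s≤s z≤n
    positive-sum zero    (suc j) _  = s≤s z≤n
    positive-sum zero    zero    nz = ⊥-elim (nz (refl , refl))

uDegree+length : ∀ p → All NonZeroPair p →
                 uDegree p + length p ≡ tDegree p + sum (map proj₂ p)
uDegree+length []      []          = refl
uDegree+length (x ∷ p) (nz ∷ nzs) = begin
  uDeg x + uDegree p + suc (length p)             ≡⟨ +-suc (uDeg x + uDegree p) (length p) ⟩
  suc (uDeg x + uDegree p + length p)             ≡⟨ cong suc (+-assoc (uDeg x) (uDegree p) (length p)) ⟩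
  suc (uDeg x) + (uDegree p + length p)           ≡⟨ cong₂ _+_ (suc-uDeg x nz) (uDegree+length p nzs) ⟩
  proj₁ x + proj₂ x + (tDegree p + sum (map proj₂ p)) ≡⟨ interchange (proj₁ x) (proj₂ x) (tDegree p) _ ⟩
  tDegree (x ∷ p) + sum (map proj₂ (x ∷ p))       ∎
  where open ≡-Reasoning

sumSnd⇔uDegree : ∀ n p → All NonZeroPair p → tDegree p ≡ suc n →
                 sum (map proj₂ p) ≡ length p ∸ 1 ⇔ uDegree p ≡ n
sumSnd⇔uDegree n [] _ ()
sumSnd⇔uDegree n (x ∷ p) nzs tDeg = mk⇔
  (λ sJ → +-cancelʳ-≡ (length p) _ _ (suc-injective (begin
    suc (uDegree (x ∷ p) + length p) ≡⟨ identity ⟩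
    suc (n + sum (map proj₂ (x ∷ p))) ≡⟨ cong (λ s → suc (n + s)) sJ ⟩
    suc (n + length p)               ∎)))
  (λ uD → sym (+-cancelˡ-≡ n _ _ (suc-injective (begin
    suc (n + length p)                ≡⟨ cong (λ u → suc (u + length p)) (sym uD) ⟩
    suc (uDegree (x ∷ p) + length p)  ≡⟨ identity ⟩
    suc (n + sum (map proj₂ (x ∷ p))) ∎))))
  where
    open ≡-Reasoning
    identity : suc (uDegree (x ∷ p) + length p) ≡ suc (n + sum (map proj₂ (x ∷ p)))
    identity = begin
      suc (uDegree (x ∷ p) + length p)  ≡⟨ sym (+-suc (uDegree (x ∷ p)) (length p)) ⟩
      uDegree (x ∷ p) + length (x ∷ p)  ≡⟨ uDegree+length (x ∷ p) nzs ⟩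
      tDegree (x ∷ p) + sum (map proj₂ (x ∷ p)) ≡⟨ cong (_+ sum (map proj₂ (x ∷ p))) tDeg ⟩
      suc (n + sum (map proj₂ (x ∷ p))) ∎

-- A counted partition of n + 1 is a sorted list over E≤ N of bidegree (n + 1 , n) when
-- N ≥ n + 1: its parts have coordinates ≤ n + 1, and conversely every such list is counted.
counted⇒sortedOver : ∀ N n p → suc n ≤ N → Counted (suc n) p → SortedOver (E≤ N) (suc n) n p
counted⇒sortedOver N n p n<N (partition , ∉01) = record
  { sorted = sorted′ ; letters = All.tabulate inE≤N ; tDegree≡ = sumFst ; uDegree≡ = uDeg≡ }
  where
    open TwoDimPartition partition renaming (sorted to sorted′)
    uDeg≡ : uDegree p ≡ n
    uDeg≡ = Equivalence.to (sumSnd⇔uDegree n p nonzero sumFst) sumSnd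
    inE≤N : ∀ {x} → x ∈ p → x ∈ E≤ N
    inE≤N {i , j} x∈ = ∈-E≤⁺ N i j
      (nonZero⇒inE i j (lookup nonzero x∈) (λ { refl → ∉01 x∈ }))
      (≤-trans (subst (i ≤_) sumFst (∈⇒≤sum proj₁ x∈)) n<N)
      (≤-trans j≤n+1 n<N)
      where
        j≤n+1 : j ≤ suc n
        j≤n+1 = begin
          j                   ≤⟨ m≤n+m j i ⟩
          i + j               ≡⟨ sym (suc-uDeg (i , j) (lookup nonzero x∈)) ⟩
          suc (uDeg (i , j))  ≤⟨ s≤s (∈⇒≤sum uDeg x∈) ⟩
          suc (uDegree p)     ≡⟨ cong suc uDeg≡ ⟩
          suc n               ∎
          where open ≤-Reasoning

sortedOver⇒counted : ∀ N n p → SortedOver (E≤ N) (suc n) n p → Counted (suc n) p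
sortedOver⇒counted N n p p-over =
  record { sorted = sorted p-over ; nonzero = nonzero ; sumFst = tDegree≡ p-over
         ; sumSnd = Equivalence.from (sumSnd⇔uDegree n p nonzero (tDegree≡ p-over)) (uDegree≡ p-over) } ,
  λ ∈p → ∈-E≤⁻ N (lookup (letters p-over) ∈p)
  where
    nonzero : All NonZeroPair p
    nonzero = All.map (λ { {i , j} x∈ → inE⇒nonZero i j (∈-E≤⁻ N x∈) }) (letters p-over)

enum-E≤-members : ∀ N n → suc n ≤ N → ∀ p → p ∈ enum (E≤ N) (suc n) n ⇔ Counted (suc n) p
enum-E≤-members N n n<N p = mk⇔
  (sortedOver⇒counted N n p ∘ enum-sound (E≤ N) (E≤-sorted N) (suc n) n)
  (enum-complete (E≤ N) (E≤-sorted N) (E≤-positive N) (suc n) n ∘ counted⇒sortedOver N n p n<N)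

mainTheorem2 : (n : ℕ) → 1 ≤ n →
    Σ (List (List Pair)) λ L →
    Unique L × ((p : List Pair) → (p ∈ L) ⇔ Counted n p) × InfProdCoeff n (n ∸ 1) (length L)
mainTheorem2 (suc n) _ =
  enum (E≤ (suc n)) (suc n) n ,
  enum-unique (E≤ (suc n)) (E≤-sorted (suc n)) (suc n) n ,
  enum-E≤-members (suc n) n ≤-refl ,
  suc n , stable
  where
    stable : ∀ N → suc n ≤ N → partialProduct N (suc n) n ≡ length (enum (E≤ (suc n)) (suc n) n)
    stable N n<N = begin
      partialProduct N (suc n) n              ≡⟨ sym (length-enum (E≤ N) (suc n) n) ⟩
      length (enum (E≤ N) (suc n) n)          ≡⟨ sameMembers⇒sameLength
                                                   (enum-unique (E≤ N) (E≤-sorted N) (suc n) n)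
                                                   (enum-unique (E≤ (suc n)) (E≤-sorted (suc n)) (suc n) n)
                                                   (λ {p} → ⇔-sym (enum-E≤-members (suc n) n ≤-refl p)
                                                              ⇔-∘ enum-E≤-members N n n<N p) ⟩
      length (enum (E≤ (suc n)) (suc n) n)    ∎
      where open ≡-Reasoning
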